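{- Let $J$ be a set of unit-time, unit-consumption jobs with acyclic precedence graph $G$, let $P$ be a critical path of $G$ and $m^*$ the size of a maximum matching in the independence graph $\widetilde{G}$. For any makespan deadline $M\in\{|P|,\dots,|J|-m^*\}$, every optimal schedule (resource level $2$, makespan at most $M$) has makespan exactly $M$.
   Context: Schedules are $x\in\mathbb{N}^J$, feasible if $x_i+1\le x_j$ for each arc $(i,j)$ of $G$ and $C_{max}(x)=\max_i(x_i+1)\le M$. With $r_\tau(x)=|\{i:x_i=\tau\}|$, the objective to maximize is $F(x)=\sum_{\tau=0}^{C_{max}(x)-1}\min(2,r_\tau(x))$. A critical path is a path of $G$ with the maximum number of jobs. Two distinct jobs are independent if there is no directed path between them in $G$; $\widetilde{G}$ is the graph on $J$ whose edges are the independent pairs. -}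

module Defs where

open import Data.Nat using (ℕ; zero; suc; _+_; _≤_; _⊔_; _⊓_)
open import Data.Nat.Properties using (_≟_)
open import Data.Fin using (Fin)
open import Data.List using (List; []; _∷_; length; filter; map; foldr; upTo; allFin; concatMap)
open import Data.Nat.ListAction using (sum)
open import Data.Unit using (⊤)
open import Data.List.Relation.Unary.All using (All)
open import Data.List.Relation.Unary.Unique.Propositional using (Unique)
open import Data.Product using (_×_; _,_; proj₁; proj₂)
open import Relation.Nullary using (¬_)
open import Relation.Binary.PropositionalEquality using (_≡_; _≢_)
open import Relation.Binary.Construct.Closure.Transitive using (TransClosure)

-- Jobs are Fin n; the precedence graph G is an arc relation E on Fin n.
Graph : ℕ → Set₁
Graph n = Fin n → Fin n → Set

Reach : ∀ {n} → Graph n → Fin n → Fin n → Set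
Reach E = TransClosure E

Acyclic : ∀ {n} → Graph n → Set
Acyclic {n} E = (i : Fin n) → ¬ Reach E i i

IsPath : ∀ {n} → Graph n → List (Fin n) → Set
IsPath E [] = ⊤
IsPath E (i ∷ []) = ⊤
IsPath E (i ∷ j ∷ p) = E i j × IsPath E (j ∷ p)

IsCriticalPath : ∀ {n} → Graph n → List (Fin n) → Set
IsCriticalPath E P = IsPath E P × (∀ Q → IsPath E Q → length Q ≤ length P)

-- independence of two distinct jobs (edge of the independence graph G̃)
Independent : ∀ {n} → Graph n → Fin n → Fin n → Set
Independent E i j = i ≢ j × ¬ Reach E i j × ¬ Reach E j i

endpoints : ∀ {n} → List (Fin n × Fin n) → List (Fin n)
endpoints = concatMap (λ e → proj₁ e ∷ proj₂ e ∷ [])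

IsMatching : ∀ {n} → Graph n → List (Fin n × Fin n) → Set
IsMatching E Mt = All (λ e → Independent E (proj₁ e) (proj₂ e)) Mt × Unique (endpoints Mt)

IsMaxMatching : ∀ {n} → Graph n → List (Fin n × Fin n) → Set
IsMaxMatching E Mt = IsMatching E Mt × (∀ Mt' → IsMatching E Mt' → length Mt' ≤ length Mt)

Schedule : ℕ → Set
Schedule n = Fin n → ℕ

Cmax : ∀ {n} → Schedule n → ℕ
Cmax {n} x = foldr (λ i acc → suc (x i) ⊔ acc) 0 (allFin n)

r : ∀ {n} → Schedule n → ℕ → ℕ
r {n} x τ = length (filter (λ i → x i ≟ τ) (allFin n))

F : ∀ {n} → Schedule n → ℕ
F x = sum (map (λ τ → 2 ⊓ r x τ) (upTo (Cmax x)))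

Feasible : ∀ {n} → Graph n → ℕ → Schedule n → Set
Feasible {n} E M x = (∀ (i j : Fin n) → E i j → suc (x i) ≤ x j) × Cmax x ≤ M

Optimal : ∀ {n} → Graph n → ℕ → Schedule n → Set
Optimal {n} E M x = Feasible E M x × (∀ (y : Schedule n) → Feasible E M y → F y ≤ F x)

{-# OPTIONS --safe #-}
module Submission where

-- Suppose an optimal schedule x finished before M. Then no time slot τ holds three jobs:
-- keeping one job a of slot τ in place and delaying every other job starting at or after τ
-- by one unit keeps the schedule feasible within M, and it raises F, since the usage of
-- slot τ (at most 2) is now spread over the slots τ and τ + 1 with usages at least 1 and 2.
-- So every slot holds at most two jobs, and two jobs sharing a slot are independent; the
-- doubly occupied slots form a matching of G̃, whence |J| ≤ C_max(x) + m* < M + m*.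

open import Defs
open import Data.Nat using (ℕ; zero; suc; _+_; _≤_; _<_; _⊓_; _⊔_; z≤n; s≤s; z<s)
open import Data.Nat.Properties
open import Data.Fin using (Fin)
import Data.Fin.Properties as Fin
open import Data.List using (List; []; _∷_; length; filter; map; foldr; applyUpTo; allFin)
open import Data.List.Properties using (filter-none; filter-all; filter-some; length-tabulate)
open import Data.Nat.ListAction using (sum)
open import Data.List.Relation.Unary.All as All using (All; []; _∷_)
open import Data.List.Relation.Unary.All.Properties using (all-filter)
open import Data.List.Relation.Unary.Any as Any using (here; there)
open import Data.List.Relation.Unary.AllPairs using ([]; _∷_)
open import Data.List.Relation.Unary.Unique.Propositional using (Unique)
import Data.List.Relation.Unary.Unique.Propositional.Properties as Unique
open import Data.List.Relation.Binary.Sublist.Propositional using (⊆-refl)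
open import Data.List.Relation.Binary.Sublist.Propositional.Properties using (filter⁺; length-mono-≤)
open import Data.List.Membership.Propositional using (_∈_)
open import Data.List.Membership.Propositional.Properties using (∈-allFin)
open import Data.Product using (_×_; _,_; proj₁; proj₂; ∃-syntax)
open import Data.Sum using (_⊎_; inj₁; inj₂)
open import Data.Empty using (⊥)
open import Function using (_∘_)
open import Level using (0ℓ)
open import Relation.Nullary using (yes; no; contradiction)
open import Relation.Unary using (Pred; Decidable)
open import Relation.Unary.Properties using (_∪?_)
open import Relation.Binary.Definitions using (DecidableEquality)
open import Relation.Binary.PropositionalEquality
  using (_≡_; refl; sym; trans; cong; cong₂; _≢_; ≢-sym)
open import Relation.Binary.Construct.Closure.Transitive using ([_]; _∷_)

module _ {A : Set} where

  length-filter-mono : {P Q : Pred A 0ℓ} (P? : Decidable P) (Q? : Decidable Q) →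
                       (∀ {a} → P a → Q a) → ∀ xs →
                       length (filter P? xs) ≤ length (filter Q? xs)
  length-filter-mono P? Q? P⇒Q xs =
    length-mono-≤ (filter⁺ P? Q? (λ { refl → P⇒Q }) (⊆-refl {x = xs}))

  length-filter-∪ : {Q R : Pred A 0ℓ} (Q? : Decidable Q) (R? : Decidable R) → ∀ xs →
                    length (filter (Q? ∪? R?) xs) ≤ length (filter Q? xs) + length (filter R? xs)
  length-filter-∪ Q? R? [] = z≤n
  length-filter-∪ Q? R? (a ∷ xs) with ih ← length-filter-∪ Q? R? xs | Q? a | R? a
  ... | yes _ | yes _ = s≤s (≤-trans ih (+-monoʳ-≤ _ (n≤1+n _)))
  ... | yes _ | no _  = s≤s ih
  ... | no _  | yes _ = ≤-trans (s≤s ih) (≤-reflexive (sym (+-suc _ _)))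
  ... | no _  | no _  = ih

  length-filter-≡-≤1 : (_≟ᴬ_ : DecidableEquality A) (a : A) {xs : List A} → Unique xs →
                       length (filter (_≟ᴬ a) xs) ≤ 1
  length-filter-≡-≤1 _≟ᴬ_ a [] = z≤n
  length-filter-≡-≤1 _≟ᴬ_ a {b ∷ xs} (b∉xs ∷ u) with b ≟ᴬ a
  ... | yes refl = s≤s (≤-reflexive (cong length (filter-none (_≟ᴬ b) (All.map ≢-sym b∉xs))))
  ... | no _     = length-filter-≡-≤1 _≟ᴬ_ a u

module _ {n : ℕ} where

  RespectsPrecedences : Graph n → Schedule n → Set
  RespectsPrecedences E x = ∀ i j → E i j → suc (x i) ≤ x j

  reach⇒< : ∀ {E x} → RespectsPrecedences E x → ∀ {i j} → Reach E i j → x i < x j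
  reach⇒< arc [ e ]   = arc _ _ e
  reach⇒< arc (e ∷ p) = <-trans (arc _ _ e) (reach⇒< arc p)

  <Cmax : ∀ (x : Schedule n) i → x i < Cmax x
  <Cmax x i = go (allFin n) (∈-allFin i)
    where
    go : ∀ js → i ∈ js → x i < foldr (λ j acc → suc (x j) ⊔ acc) 0 js
    go (j ∷ js) (here refl) = m≤m⊔n (suc (x j)) (foldr (λ j acc → suc (x j) ⊔ acc) 0 js)
    go (j ∷ js) (there i∈js) = ≤-trans (go js i∈js) (m≤n⊔m _ _)

  Cmax-lub : ∀ (x : Schedule n) {K} → (∀ i → x i < K) → Cmax x ≤ K
  Cmax-lub x {K} x<K = go (allFin n)
    where
    go : ∀ js → foldr (λ j acc → suc (x j) ⊔ acc) 0 js ≤ K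
    go []       = z≤n
    go (j ∷ js) = ⊔-lub (x<K j) (go js)

  slot : Schedule n → ℕ → List (Fin n)
  slot x τ = filter (λ i → x i ≟ τ) (allFin n)

  slot-unique : ∀ x τ → Unique (slot x τ)
  slot-unique x τ = Unique.filter⁺ (λ i → x i ≟ τ) (Unique.allFin⁺ n)

  r-mono : ∀ {x y : Schedule n} {σ σ′} → (∀ {i} → x i ≡ σ → y i ≡ σ′) → r x σ ≤ r y σ′
  r-mono {x} {y} {σ} {σ′} x⇒y = length-filter-mono (λ i → x i ≟ σ) (λ i → y i ≟ σ′) x⇒y (allFin n)

  r-beyond-Cmax : ∀ x {τ} → Cmax x ≤ τ → r x τ ≡ 0
  r-beyond-Cmax x {τ} C≤τ = cong length (filter-none (λ i → x i ≟ τ) {allFin n}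
    (All.tabulate λ {i} _ xi≡τ → <⇒≱ (<Cmax x i) (≤-trans C≤τ (≤-reflexive (sym xi≡τ)))))

  job-in-slot : ∀ x {τ} → 0 < r x τ → ∃[ a ] x a ≡ τ
  job-in-slot x {τ} 0<r = go (slot x τ) (all-filter (λ i → x i ≟ τ) (allFin n)) 0<r
    where
    go : ∀ js → All (λ i → x i ≡ τ) js → 0 < length js → ∃[ a ] x a ≡ τ
    go (j ∷ _) (xj≡τ ∷ _) _ = j , xj≡τ

-- The resource consumed at time τ under resource level 2.
usage : ∀ {n} → Schedule n → ℕ → ℕ
usage x τ = 2 ⊓ r x τ

∑< : ℕ → (ℕ → ℕ) → ℕ
∑< zero    f = 0
∑< (suc k) f = f 0 + ∑< k (f ∘ suc)

sum-map-applyUpTo : ∀ (f h : ℕ → ℕ) k → sum (map f (applyUpTo h k)) ≡ ∑< k (f ∘ h)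
sum-map-applyUpTo f h zero    = refl
sum-map-applyUpTo f h (suc k) = cong (f (h 0) +_) (sum-map-applyUpTo f (h ∘ suc) k)

F≡∑<usage : ∀ {n} (x : Schedule n) → F x ≡ ∑< (Cmax x) (usage x)
F≡∑<usage x = sum-map-applyUpTo (usage x) (λ τ → τ) (Cmax x)

∑<-mono : ∀ k {f h} → (∀ σ → f σ ≤ h σ) → ∑< k f ≤ ∑< k h
∑<-mono zero    f≤h = z≤n
∑<-mono (suc k) f≤h = +-mono-≤ (f≤h 0) (∑<-mono k (f≤h ∘ suc))

∑<-extend : ∀ {C K f} → (∀ σ → C ≤ σ → f σ ≡ 0) → C ≤ K → ∑< K f ≡ ∑< C f
∑<-extend {zero}  {zero}      f≡0 _ = refl
∑<-extend {zero}  {suc K}     f≡0 _ =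
  cong₂ _+_ (f≡0 0 z≤n) (∑<-extend {zero} {K} (λ σ _ → f≡0 (suc σ) z≤n) z≤n)
∑<-extend {suc C} {suc K} {f} f≡0 (s≤s C≤K) =
  cong (f 0 +_) (∑<-extend (λ σ C≤σ → f≡0 (suc σ) (s≤s C≤σ)) C≤K)

∑<-spread-< : ∀ τ k {f h} → (∀ σ → σ < τ → f σ ≤ h σ) → f τ < h τ + h (suc τ) →
              (∀ σ → f (suc τ + σ) ≤ h (suc (suc τ) + σ)) →
              ∑< (suc τ + k) f < ∑< (suc (suc τ) + k) h
∑<-spread-< zero k {f} {h} _ fτ< tail≤ = begin-strict
  f 0 + ∑< k (f ∘ suc)                 <⟨ +-mono-<-≤ fτ< (∑<-mono k tail≤) ⟩
  h 0 + h 1 + ∑< k (h ∘ suc ∘ suc)     ≡⟨ +-assoc (h 0) _ _ ⟩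
  h 0 + (h 1 + ∑< k (h ∘ suc ∘ suc))   ∎
  where open ≤-Reasoning
∑<-spread-< (suc τ) k head≤ fτ< tail≤ =
  +-mono-≤-< (head≤ 0 z<s) (∑<-spread-< τ k (λ σ σ<τ → head≤ (suc σ) (s≤s σ<τ)) fτ< tail≤)

module _ {n : ℕ} where

  postpone : Schedule n → ℕ → Fin n → Schedule n
  postpone x τ a i with x i <? τ | i Fin.≟ a
  ... | yes _ | _     = x i
  ... | no _  | yes _ = x i
  ... | no _  | no _  = suc (x i)

  module _ (x : Schedule n) (τ : ℕ) (a : Fin n) where

    postpone-early : ∀ {i} → x i < τ → postpone x τ a i ≡ x i
    postpone-early {i} xi<τ with x i <? τ
    ... | yes _ = refl
    ... | no xi≮τ = contradiction xi<τ xi≮τ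

    postpone-kept : postpone x τ a a ≡ x a
    postpone-kept with x a <? τ | a Fin.≟ a
    ... | yes _ | _      = refl
    ... | no _  | yes _  = refl
    ... | no _  | no a≢a = contradiction refl a≢a

    postpone-late : ∀ {i} → τ ≤ x i → i ≢ a → postpone x τ a i ≡ suc (x i)
    postpone-late {i} τ≤xi i≢a with x i <? τ | i Fin.≟ a
    ... | yes xi<τ | _      = contradiction τ≤xi (<⇒≱ xi<τ)
    ... | no _     | yes i≡a = contradiction i≡a i≢a
    ... | no _     | no _    = refl

    postpone-≥ : ∀ i → x i ≤ postpone x τ a i
    postpone-≥ i with x i <? τ | i Fin.≟ a
    ... | yes _ | _     = ≤-refl
    ... | no _  | yes _ = ≤-refl
    ... | no _  | no _  = n≤1+n _

    postpone-≤ : ∀ i → postpone x τ a i ≤ suc (x i)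
    postpone-≤ i with x i <? τ | i Fin.≟ a
    ... | yes _ | _     = n≤1+n _
    ... | no _  | yes _ = n≤1+n _
    ... | no _  | no _  = ≤-refl

    Cmax-postpone : Cmax (postpone x τ a) ≤ suc (Cmax x)
    Cmax-postpone = Cmax-lub (postpone x τ a) λ i → s≤s (≤-trans (postpone-≤ i) (<Cmax x i))

    module _ (xa≡τ : x a ≡ τ) where

      private
        y : Schedule n
        y = postpone x τ a

        later-than-a : ∀ {i} → τ < x i → i ≢ a
        later-than-a τ<xi refl = <⇒≢ τ<xi (sym xa≡τ)

      -- Splitting on τ ≤? x i and a ≟ i, not on the scrutinees of postpone, keeps y i
      -- in the goal from being abstracted away.
      postpone-respects : ∀ {E} → RespectsPrecedences E x → RespectsPrecedences E y
      postpone-respects arc i j e with τ ≤? x i | a Fin.≟ i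
      ... | no τ≰xi | _ = begin-strict
        y i  ≡⟨ postpone-early (≰⇒> τ≰xi) ⟩
        x i  <⟨ arc i j e ⟩
        x j  ≤⟨ postpone-≥ j ⟩
        y j  ∎
        where open ≤-Reasoning
      ... | yes _ | yes refl = begin-strict
        y a  ≡⟨ postpone-kept ⟩
        x a  <⟨ arc a j e ⟩
        x j  ≤⟨ postpone-≥ j ⟩
        y j  ∎
        where open ≤-Reasoning
      ... | yes τ≤xi | no a≢i = begin-strict
        y i        ≡⟨ postpone-late τ≤xi (≢-sym a≢i) ⟩
        suc (x i)  <⟨ s≤s (arc i j e) ⟩
        suc (x j)  ≡⟨ postpone-late (<⇒≤ τ<xj) (later-than-a τ<xj) ⟨
        y j        ∎
        where
        open ≤-Reasoning
        τ<xj : τ < x j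
        τ<xj = <-≤-trans (s≤s τ≤xi) (arc i j e)

      r-postpone-early : ∀ σ → σ < τ → r x σ ≤ r y σ
      r-postpone-early σ σ<τ = r-mono {x = x} {y = y} λ {i} xi≡σ →
        trans (postpone-early (≤-<-trans (≤-reflexive xi≡σ) σ<τ)) xi≡σ

      r-postpone-kept : 1 ≤ r y τ
      r-postpone-kept =
        filter-some (λ i → y i ≟ τ) (Any.map (λ { refl → trans postpone-kept xa≡τ }) (∈-allFin a))

      r-postpone-slot : r x τ ≤ r y (suc τ) + 1
      r-postpone-slot = begin
        r x τ
          ≤⟨ length-filter-mono _ (ys? ∪? a?) moved-or-a (allFin n) ⟩
        length (filter (ys? ∪? a?) (allFin n))
          ≤⟨ length-filter-∪ ys? a? (allFin n) ⟩
        r y (suc τ) + length (filter a? (allFin n))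
          ≤⟨ +-monoʳ-≤ _ (length-filter-≡-≤1 Fin._≟_ a (Unique.allFin⁺ n)) ⟩
        r y (suc τ) + 1
          ∎
        where
        open ≤-Reasoning
        ys? : Decidable (λ i → y i ≡ suc τ)
        ys? i = y i ≟ suc τ
        a? : Decidable (_≡ a)
        a? i = i Fin.≟ a
        moved-or-a : ∀ {i} → x i ≡ τ → y i ≡ suc τ ⊎ i ≡ a
        moved-or-a {i} xi≡τ with a Fin.≟ i
        ... | yes refl = inj₂ refl
        ... | no a≢i   =
          inj₁ (trans (postpone-late (≤-reflexive (sym xi≡τ)) (≢-sym a≢i)) (cong suc xi≡τ))

      r-postpone-late : ∀ σ → r x (suc τ + σ) ≤ r y (suc (suc τ) + σ)
      r-postpone-late σ = r-mono {x = x} {y = y} λ {i} xi≡ →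
        let τ<xi = ≤-trans (s≤s (m≤m+n τ σ)) (≤-reflexive (sym xi≡)) in
        trans (postpone-late (<⇒≤ τ<xi) (later-than-a τ<xi)) (cong suc xi≡)

      usage-postpone-slot : 3 ≤ r x τ → usage x τ < usage y τ + usage y (suc τ)
      usage-postpone-slot 3≤r = begin-strict
        usage x τ                    ≤⟨ m⊓n≤m 2 (r x τ) ⟩
        2                            <⟨ +-mono-≤ (⊓-glb z<s r-postpone-kept) (⊓-glb ≤-refl 2≤r) ⟩
        usage y τ + usage y (suc τ)  ∎
        where
        open ≤-Reasoning
        2≤r : 2 ≤ r y (suc τ)
        2≤r = ≤-pred (≤-trans 3≤r (≤-trans r-postpone-slot (≤-reflexive (+-comm _ 1))))

      postpone-improves : 3 ≤ r x τ → F x < F y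
      postpone-improves 3≤r = begin-strict
        F x
          ≡⟨ F≡∑<usage x ⟩
        ∑< (Cmax x) (usage x)
          ≡⟨ cong (λ C → ∑< C (usage x)) Cmax≡ ⟨
        ∑< (suc τ + k) (usage x)
          <⟨ ∑<-spread-< τ k (λ σ σ<τ → ⊓-monoʳ-≤ 2 (r-postpone-early σ σ<τ))
                             (usage-postpone-slot 3≤r)
                             (λ σ → ⊓-monoʳ-≤ 2 (r-postpone-late σ)) ⟩
        ∑< (suc (suc τ) + k) (usage y)
          ≡⟨ ∑<-extend (λ σ C≤σ → cong (2 ⊓_) (r-beyond-Cmax y C≤σ)) Cmaxy≤ ⟩
        ∑< (Cmax y) (usage y)
          ≡⟨ F≡∑<usage y ⟨
        F y
          ∎
        where
        open ≤-Reasoning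
        τ<Cmax : τ < Cmax x
        τ<Cmax = ≤-trans (s≤s (≤-reflexive (sym xa≡τ))) (<Cmax x a)
        k : ℕ
        k = proj₁ (m≤n⇒∃[o]m+o≡n τ<Cmax)
        Cmax≡ : suc τ + k ≡ Cmax x
        Cmax≡ = proj₂ (m≤n⇒∃[o]m+o≡n τ<Cmax)
        Cmaxy≤ : Cmax y ≤ suc (suc τ) + k
        Cmaxy≤ = ≤-trans Cmax-postpone (s≤s (≤-reflexive (sym Cmax≡)))

      postpone-feasible : ∀ {E M} → RespectsPrecedences E x → Cmax x < M → Feasible E M y
      postpone-feasible arc C<M = postpone-respects arc , ≤-trans Cmax-postpone C<M

optimal∧Cmax<M⇒r≤2 : ∀ {n E M} {x : Schedule n} → Optimal E M x → Cmax x < M → ∀ τ → r x τ ≤ 2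
optimal∧Cmax<M⇒r≤2 {x = x} ((arc , _) , optimal) C<M τ = ≮⇒≥ λ 3≤r →
  let a , xa≡τ = job-in-slot x (≤-trans z<s 3≤r) in
  <⇒≱ (postpone-improves x τ a xa≡τ 3≤r) (optimal _ (postpone-feasible x τ a xa≡τ arc C<M))

module _ {n : ℕ} {E : Graph n} {x : Schedule n} (arc : RespectsPrecedences E x) where

  private
    early : ℕ → ℕ
    early τ = length (filter (λ i → x i <? τ) (allFin n))

    early-suc : ∀ τ → early (suc τ) ≤ early τ + r x τ
    early-suc τ = ≤-trans
      (length-filter-mono (λ i → x i <? suc τ) (earlier? ∪? at?) (m≤n⇒m<n∨m≡n ∘ ≤-pred) (allFin n))
      (length-filter-∪ earlier? at? (allFin n))
      where
      earlier? : Decidable (λ i → x i < τ)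
      earlier? i = x i <? τ
      at? : Decidable (λ i → x i ≡ τ)
      at? i = x i ≟ τ

    early-Cmax : early (Cmax x) ≡ n
    early-Cmax = trans
      (cong length (filter-all (λ i → x i <? Cmax x) {allFin n} (All.tabulate λ {i} _ → <Cmax x i)))
      (length-tabulate {n = n} (λ i → i))

    same-slot-independent : ∀ {a b} → x a ≡ x b → a ≢ b → Independent E a b
    same-slot-independent xa≡xb a≢b =
      a≢b , (λ a⇝b → <⇒≢ (reach⇒< arc a⇝b) xa≡xb) , (λ b⇝a → <⇒≢ (reach⇒< arc b⇝a) (sym xa≡xb))

    covers-step : ∀ {e′ e s τ p d} → e′ ≤ e + s → e ≤ τ + p → s ≤ suc d → e′ ≤ suc τ + (d + p)
    covers-step {e′} {e} {s} {τ} {p} {d} e′≤ e≤ s≤ = begin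
      e′                ≤⟨ e′≤ ⟩
      e + s             ≤⟨ +-mono-≤ e≤ s≤ ⟩
      τ + p + suc d     ≡⟨ +-suc (τ + p) d ⟩
      suc (τ + p + d)   ≡⟨ cong suc (+-assoc τ p d) ⟩
      suc (τ + (p + d)) ≡⟨ cong (λ q → suc (τ + q)) (+-comm p d) ⟩
      suc τ + (d + p)   ∎
      where open ≤-Reasoning

    -- Each of the first τ slots holds at most one job that no pair covers.
    record MatchingBefore (τ : ℕ) : Set where
      field
        pairs      : List (Fin n × Fin n)
        isMatching : IsMatching E pairs
        before     : All (λ i → x i < τ) (endpoints pairs)
        covers     : early τ ≤ τ + length pairs

    open MatchingBefore

    unchanged : ∀ {τ} (S : List (Fin n)) → length S ≤ 1 → early (suc τ) ≤ early τ + length S →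
                MatchingBefore τ → MatchingBefore (suc τ)
    unchanged {τ} S S≤1 grow m = record
      { pairs      = pairs m
      ; isMatching = isMatching m
      ; before     = All.map m<n⇒m<1+n (before m)
      ; covers     = covers-step {τ = τ} grow (covers m) S≤1
      }

    extend : ∀ {τ} (S : List (Fin n)) → All (λ i → x i ≡ τ) S → Unique S → length S ≤ 2 →
             early (suc τ) ≤ early τ + length S → MatchingBefore τ → MatchingBefore (suc τ)
    extend []      _ _ _ = unchanged [] z≤n
    extend (a ∷ []) _ _ _ = unchanged (a ∷ []) ≤-refl
    extend {τ} (a ∷ b ∷ []) (xa≡τ ∷ xb≡τ ∷ []) ((a≢b ∷ []) ∷ _) _ grow m = record
      { pairs      = (a , b) ∷ pairs m
      ; isMatching = same-slot-independent (trans xa≡τ (sym xb≡τ)) a≢b ∷ proj₁ (isMatching m)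
                   , (a≢b ∷ fresh xa≡τ) ∷ fresh xb≡τ ∷ proj₂ (isMatching m)
      ; before     = s≤s (≤-reflexive xa≡τ) ∷ s≤s (≤-reflexive xb≡τ) ∷ All.map m<n⇒m<1+n (before m)
      ; covers     = covers-step {τ = τ} grow (covers m) ≤-refl
      }
      where
      fresh : ∀ {c} → x c ≡ τ → All (c ≢_) (endpoints (pairs m))
      fresh xc≡τ = All.map (λ xi<τ c≡i → <⇒≢ xi<τ (trans (cong x (sym c≡i)) xc≡τ)) (before m)
    extend (_ ∷ _ ∷ _ ∷ _) _ _ (s≤s (s≤s ()))

    matchingBefore : (∀ τ → r x τ ≤ 2) → ∀ τ → MatchingBefore τ
    matchingBefore r≤2 zero = record
      { pairs      = []
      ; isMatching = [] , []
      ; before     = []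
      ; covers     = ≤-reflexive
                       (cong length (filter-none (λ i → x i <? 0) {allFin n} (All.tabulate λ _ ())))
      }
    matchingBefore r≤2 (suc τ) =
      extend (slot x τ) (all-filter (λ i → x i ≟ τ) (allFin n)) (slot-unique x τ)
             (r≤2 τ) (early-suc τ) (matchingBefore r≤2 τ)

  r≤2⇒matching : (∀ τ → r x τ ≤ 2) → ∃[ Mt ] IsMatching E Mt × n ≤ Cmax x + length Mt
  r≤2⇒matching r≤2 = pairs m , isMatching m , ≤-trans (≤-reflexive (sym early-Cmax)) (covers m)
    where
    m : MatchingBefore (Cmax x)
    m = matchingBefore r≤2 (Cmax x)

lemma2 : (n : ℕ) (E : Graph n) → Acyclic E →
         (P : List (Fin n)) → IsCriticalPath E P →
         (Mt : List (Fin n × Fin n)) → IsMaxMatching E Mt →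
         (M : ℕ) → length P ≤ M → M + length Mt ≤ n →
         (x : Schedule n) → Optimal E M x → Cmax x ≡ M
lemma2 n E _ _ _ Mt (_ , maximum) M _ M+m≤n x optimal@((arc , C≤M) , _) =
  ≤-antisym C≤M (≮⇒≥ no-slack)
  where
  no-slack : Cmax x < M → ⊥
  no-slack C<M with r≤2⇒matching arc (optimal∧Cmax<M⇒r≤2 optimal C<M)
  ... | Mt′ , matching′ , n≤C+m′ = <-irrefl refl (begin-strict
    n                    ≤⟨ n≤C+m′ ⟩
    Cmax x + length Mt′  ≤⟨ +-monoʳ-≤ (Cmax x) (maximum Mt′ matching′) ⟩
    Cmax x + length Mt   <⟨ +-monoˡ-< (length Mt) C<M ⟩
    M + length Mt        ≤⟨ M+m≤n ⟩
    n                    ∎)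
    where open ≤-Reasoning
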